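{- Let $n$ be a positive integer and let $m,k$ be positive integers with $1\leq m\leq n-1$ and $1\leq k\leq n-m$. Then \[ X_{n}^{m,k}(x,a)\, N_{n}(x,a)=\bigl(x-a\,q^{k-1}[m]_{q}\bigr)\,X_{n}^{m,k}(x,a). \]
   Context: Let $q$ be an indeterminate, $[n]_q=1+q+\cdots+q^{n-1}$, $[n]_q!=[1]_q[2]_q\cdots[n]_q$, and ${m\brack r}_q$ the usual $q$-binomial coefficient (zero unless $0\leq r\leq m$). Let $F=(F_n)_{n\geq1}$ be a sequence of non-zero functions, $F_n!=\prod_{i=1}^n F_i$, with the convention $F_n!=[n]_q!=1$ for $n\leq 0$, and define the $F$-binomial coefficient $\binom{n}{r}_F=\frac{F_n!}{F_r!\,F_{n-r}!}$ if $0\leq r\leq n$ and $0$ otherwise. Write $\mathbb{N}_n=(n+1)(n+2)/2$ and let $O_{p,r}$ denote the $p\times r$ zero matrix and $\delta$ the Kronecker delta. The $\mathbb{N}_n\times\mathbb{N}_n$ matrix $N_n(x,a)$ is defined recursively by $N_0(x,a)=(x)$ and \[ N_n(x,a)=\begin{pmatrix} N_{n-1}(x,a) & \overline{N}_{n-1}(x,a)\\ O_{n+1,\mathbb{N}_{n-1}} & \widehat{N}_{n-1}(x,a)\end{pmatrix}, \] where $\widehat{N}_{n-1}(x,a)$ is the $(n+1)\times(n+1)$ matrix with $(i,j)$ entry $x\delta_{ij}-a\,q^{i-1}[n+1-i]_q(\delta_{ij}+\delta_{i+1,j})$, and $\overline{N}_{n-1}(x,a)$ is the $\mathbb{N}_{n-1}\times(n+1)$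 matrix whose first $\mathbb{N}_{n-2}$ rows are zero and whose last $n$ rows form the $n\times(n+1)$ matrix with $(i,j)$ entry $-aF_n(\delta_{ij}+\delta_{i+1,j})$. For positive integers $m,k$, $X_n^{m,k}(x,a)$ is the row vector of length $\mathbb{N}_n$ whose entry in position $\frac{i(i-1)}{2}+j$ (for $1\leq i\leq n+1$, $1\leq j\leq i$) is \[ X^{m,k}_{i,j}=(-1)^{i+m+k}\,a\,q^{ -(m+k-1)(i-m-k)+\binom{j-k}{2}}\,\frac{F_{i-m-k}!}{[i-m-k]_q!}\,\binom{i-1}{m+k-1}_F\,{m\brack j-k}_q . \] -}

module Defs where

open import Level using (Level; _⊔_) renaming (suc to lsuc)
open import Algebra.Bundles using (CommutativeRing)
open import Relation.Nullary using (¬_)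
open import Data.Nat using (ℕ; zero; suc; _∸_; _≤ᵇ_; _≡ᵇ_) renaming (_*_ to _*ℕ_; _+_ to _+ℕ_)
open import Data.Nat.Combinatorics using (_C_)
open import Data.Integer using (ℤ; +_; -[1+_]) renaming (_+_ to _+ℤ_; _*_ to _*ℤ_; -_ to -ℤ_; _-_ to _-ℤ_)
open import Data.Fin using (Fin; toℕ; splitAt) renaming (zero to fzero; suc to fsuc)
open import Data.Sum using (inj₁; inj₂)
open import Data.Bool using (if_then_else_)

record Field (c ℓ : Level) : Set (lsuc (c ⊔ ℓ)) where
  field
    commutativeRing : CommutativeRing c ℓ
  open CommutativeRing commutativeRing public
  field
    _⁻¹        : Carrier → Carrier
    ⁻¹-inverse : ∀ y → ¬ (y ≈ 0#) → y * (y ⁻¹) ≈ 1#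
    0≉1        : ¬ (0# ≈ 1#)

-- triangular numbers: T n = n(n+1)/2, so 𝕟_n = (n+1)(n+2)/2 = T (n+1)
T : ℕ → ℕ
T zero    = 0
T (suc n) = T n +ℕ suc n

-- ℕ binomial coefficient (t choose 2) extended to integers t by t(t-1)/2
choose2 : ℤ → ℤ
choose2 (+ n)      = + (n C 2)
choose2 -[1+ s ]   = + (suc (suc s) C 2)

module Construction {c ℓ : Level} (K : Field c ℓ)
                    (q : Field.Carrier K) (F : ℕ → Field.Carrier K)
                    (x a : Field.Carrier K) where
  open Field K

  pow : Carrier → ℕ → Carrier
  pow u zero    = 1#
  pow u (suc n) = u * pow u n

  qpow : ℤ → Carrier
  qpow (+ n)    = pow q n
  qpow -[1+ n ] = pow (q ⁻¹) (suc n)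

  ∑ : (n : ℕ) → (Fin n → Carrier) → Carrier
  ∑ zero    f = 0#
  ∑ (suc n) f = f fzero + ∑ n (λ i → f (fsuc i))

  qint : ℕ → Carrier
  qint zero    = 0#
  qint (suc n) = 1# + q * qint n

  qfact : ℕ → Carrier
  qfact zero    = 1#
  qfact (suc n) = qfact n * qint (suc n)

  Ffact : ℕ → Carrier
  Ffact zero    = 1#
  Ffact (suc n) = Ffact n * F (suc n)

  Ffactℤ : ℤ → Carrier
  Ffactℤ (+ n)    = Ffact n
  Ffactℤ -[1+ _ ] = 1#

  qfactℤ : ℤ → Carrier
  qfactℤ (+ n)    = qfact n
  qfactℤ -[1+ _ ] = 1#

  qbin : ℕ → ℤ → Carrier
  qbin m (+ r)    = if r ≤ᵇ m then qfact m * ((qfact r * qfact (m ∸ r)) ⁻¹) else 0#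
  qbin m -[1+ _ ] = 0#

  Fbin : ℕ → ℕ → Carrier
  Fbin n r = if r ≤ᵇ n then Ffact n * ((Ffact r * Ffact (n ∸ r)) ⁻¹) else 0#

  δ : ℕ → ℕ → Carrier
  δ i j = if i ≡ᵇ j then 1# else 0#

  -- \hat N_{n-1}(x,a) for N_n, with n = suc n' ; 0-based indices i j
  --   (i+1, j+1) entry:  x δ - a q^i [n - i]_q (δ_{ij} + δ_{i+1,j})
  Nhat : (n' : ℕ) → Fin (suc (suc n')) → Fin (suc (suc n')) → Carrier
  Nhat n' i j = x * δ (toℕ i) (toℕ j)
              - a * pow q (toℕ i) * qint (suc n' ∸ toℕ i)
                  * (δ (toℕ i) (toℕ j) + δ (suc (toℕ i)) (toℕ j))

  -- \bar N_{n-1}(x,a) for N_n, with n = suc n' : first T n' rows zero,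
  -- last n rows have entries - a F_n (δ_{ij} + δ_{i+1,j})
  Nbar : (n' : ℕ) → Fin (T (suc n')) → Fin (suc (suc n')) → Carrier
  Nbar n' r j with splitAt (T n') r
  ... | inj₁ _ = 0#
  ... | inj₂ i = - (a * F (suc n') * (δ (toℕ i) (toℕ j) + δ (suc (toℕ i)) (toℕ j)))

  -- N_n(x,a), an 𝕟_n × 𝕟_n matrix, 𝕟_n = T (suc n)
  N : (n : ℕ) → Fin (T (suc n)) → Fin (T (suc n)) → Carrier
  N zero    r c = x
  N (suc n) r c with splitAt (T (suc n)) r | splitAt (T (suc n)) c
  ... | inj₁ r' | inj₁ c' = N n r' c'
  ... | inj₁ r' | inj₂ c' = Nbar n r' c'
  ... | inj₂ r' | inj₁ c' = 0#
  ... | inj₂ r' | inj₂ c' = Nhat n r' c'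

  -- X^{m,k}_{i,j}  (1-based i, j)
  Xe : (m k i j : ℕ) → Carrier
  Xe m k i j =
    pow (- 1#) (i +ℕ m +ℕ k) * a
      * qpow (-ℤ (+ (m +ℕ k ∸ 1) *ℤ (+ i -ℤ + (m +ℕ k))) +ℤ choose2 (+ j -ℤ + k))
      * Ffactℤ (+ i -ℤ + (m +ℕ k)) * (qfactℤ (+ i -ℤ + (m +ℕ k)) ⁻¹)
      * Fbin (i ∸ 1) (m +ℕ k ∸ 1)
      * qbin m (+ j -ℤ + k)

  -- X_n^{m,k}(x,a): entry at (0-based) position T(i-1) + (j-1) is X_{i,j}
  X : (m k n : ℕ) → Fin (T (suc n)) → Carrier
  X m k zero    r = Xe m k 1 1
  X m k (suc n) r with splitAt (T (suc n)) r
  ... | inj₁ r' = X m k n r'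
  ... | inj₂ j  = Xe m k (suc (suc n)) (suc (toℕ j))

  rowMul : (d : ℕ) → (Fin d → Carrier) → (Fin d → Fin d → Carrier) → Fin d → Carrier
  rowMul d v M col = ∑ d (λ r → v r * M r col)

-- N_n is block upper triangular, so by induction on n only the columns of the new
-- block need checking.  There N̄ and N̂ are bidiagonal, so such a column of X N_n only
-- involves X_{i,j-1} and X_{i,j} for the last two values of i.  The entries factorise as
-- X_{i,j} = a ρ(i) γ(j), where ρ(i) holds the F-binomial and γ(j) = q^(j-k choose 2) [m, j-k]_q.
-- The row factor obeys F_{i-1} ρ(i-1) = -[i-m-k]_q q^(m+k-1) ρ(i), which turns the N̄-part
-- into a multiple of the N̂-row, and what is left is an identity between consecutive
-- q-binomial coefficients: [r+1]_q [m, r+1]_q = [m-r]_q [m, r]_q together with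
-- [u+t]_q = [u]_q + q^u [t]_q, under which the [i-m-k]_q terms cancel.
module Submission where

open import Defs
open import Level using (Level)
open import Algebra.Bundles using (CommutativeRing)
open import Data.Bool using (true; false; if_then_else_)
open import Data.Empty using (⊥-elim)
open import Data.Fin using (Fin; toℕ; _↑ˡ_; _↑ʳ_) renaming (zero to fzero; suc to fsuc)
import Data.Fin.Properties as Fin
open import Data.Integer
  using (ℤ; +_; -[1+_]; _⊖_; _◃_; sign; ∣_∣)
  renaming (_+_ to _+ℤ_; _*_ to _*ℤ_; -_ to -ℤ_; _-_ to _-ℤ_; suc to sucℤ; _≟_ to _≟ℤ_)
import Data.Integer.Properties as ℤ
open import Data.Maybe using (Maybe; just; nothing)
open import Data.Nat
  using (ℕ; zero; suc; _≤_; _<_; _∸_; _≤ᵇ_; z≤n; s≤s; compare; less; equal; greater)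
  renaming (_+_ to _+ℕ_; _*_ to _*ℕ_)
import Data.Nat.Properties as ℕ
open import Data.Nat.Combinatorics using (_C_; nC1≡n; nCk+nC[k+1]≡[n+1]C[k+1])
open import Data.Nat.Tactic.RingSolver using (solve-∀)
open import Data.Sign as Sign using (Sign)
open import Relation.Binary.PropositionalEquality as ≡ using (_≡_)
open import Relation.Nullary using (¬_; yes; no)
open import Relation.Nullary.Reflects using (ofʸ; ofⁿ)

-- Unlike Tactic.RingSolver, whose coefficients live in the ring itself, integer
-- coefficients let the solver cancel constants such as 1# - 1# in an abstract ring.
module IntegerCoefficientSolver {c ℓ : Level} (R : CommutativeRing c ℓ) where
  open CommutativeRing R
  open import Algebra.Properties.Ring ring using (-0#≈0#; -‿involutive; -‿+-comm; -1*x≈-x; -‿distribʳ-*)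
  open import Algebra.Properties.Semiring.Mult.TCOptimised semiring using (_×_; ×-homo-+; ×1-homo-*; 1+×)
  open import Algebra.Properties.CommutativeSemigroup +-commutativeSemigroup using () renaming (interchange to +-interchange)
  open import Algebra.Properties.CommutativeSemigroup *-commutativeSemigroup using () renaming (interchange to *-interchange)
  open import Algebra.Solver.Ring.AlmostCommutativeRing using (fromCommutativeRing; _-Raw-AlmostCommutative⟶_)
  open import Relation.Binary.Reasoning.Setoid setoid

  fromℤ : ℤ → Carrier
  fromℤ (+ n)    = n × 1#
  fromℤ -[1+ n ] = - (suc n × 1#)

  fromSign : Sign → Carrier
  fromSign Sign.+ = 1#
  fromSign Sign.- = - 1#

  ⊖-homo : ∀ m n → fromℤ (m ⊖ n) ≈ m × 1# - n × 1#
  ⊖-homo zero    zero    = sym (trans (+-congˡ -0#≈0#) (+-identityʳ 0#))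
  ⊖-homo (suc m) zero    = sym (trans (+-congˡ -0#≈0#) (+-identityʳ _))
  ⊖-homo zero    (suc n) = sym (+-identityˡ _)
  ⊖-homo (suc m) (suc n) = begin
    fromℤ (suc m ⊖ suc n)             ≡⟨ ≡.cong fromℤ (ℤ.[1+m]⊖[1+n]≡m⊖n m n) ⟩
    fromℤ (m ⊖ n)                     ≈⟨ ⊖-homo m n ⟩
    m × 1# - n × 1#                   ≈⟨ +-identityˡ _ ⟨
    0# + (m × 1# - n × 1#)            ≈⟨ +-congʳ (-‿inverseʳ 1#) ⟨
    (1# - 1#) + (m × 1# - n × 1#)     ≈⟨ +-interchange 1# (- 1#) (m × 1#) (- (n × 1#)) ⟩
    (1# + m × 1#) + (- 1# - n × 1#)   ≈⟨ +-cong (sym (1+× m 1#)) (trans (-‿+-comm 1# (n × 1#)) (-‿cong (sym (1+× n 1#)))) ⟩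
    suc m × 1# - suc n × 1#           ∎

  sign-◃-homo : ∀ s n → fromℤ (s ◃ n) ≈ fromSign s * n × 1#
  sign-◃-homo s      zero    = sym (zeroʳ _)
  sign-◃-homo Sign.+ (suc n) = sym (*-identityˡ _)
  sign-◃-homo Sign.- (suc n) = sym (-1*x≈-x _)

  sign-abs-homo : ∀ i → fromℤ i ≈ fromSign (sign i) * ∣ i ∣ × 1#
  sign-abs-homo i = begin
    fromℤ i                          ≡⟨ ≡.cong fromℤ (ℤ.◃-inverse i) ⟨
    fromℤ (sign i ◃ ∣ i ∣)           ≈⟨ sign-◃-homo (sign i) ∣ i ∣ ⟩
    fromSign (sign i) * ∣ i ∣ × 1#   ∎

  sign-*-homo : ∀ s t → fromSign (s Sign.* t) ≈ fromSign s * fromSign t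
  sign-*-homo Sign.+ t      = sym (*-identityˡ _)
  sign-*-homo Sign.- Sign.+ = sym (*-identityʳ _)
  sign-*-homo Sign.- Sign.- = begin
    1#             ≈⟨ -‿involutive 1# ⟨
    - - 1#         ≈⟨ -‿cong (-1*x≈-x 1#) ⟨
    - (- 1# * 1#)  ≈⟨ -‿distribʳ-* _ _ ⟩
    - 1# * - 1#    ∎

  +-homo : ∀ i j → fromℤ (i +ℤ j) ≈ fromℤ i + fromℤ j
  +-homo (+ m)    (+ n)    = ×-homo-+ 1# m n
  +-homo (+ m)    -[1+ n ] = ⊖-homo m (suc n)
  +-homo -[1+ m ] (+ n)    = trans (⊖-homo n (suc m)) (+-comm _ _)
  +-homo -[1+ m ] -[1+ n ] = begin
    - (suc (suc (m +ℕ n)) × 1#)        ≡⟨ ≡.cong (λ l → - (suc l × 1#)) (ℕ.+-suc m n) ⟨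
    - ((suc m +ℕ suc n) × 1#)          ≈⟨ -‿cong (×-homo-+ 1# (suc m) (suc n)) ⟩
    - (suc m × 1# + suc n × 1#)         ≈⟨ -‿+-comm _ _ ⟨
    - (suc m × 1#) + - (suc n × 1#)     ∎

  *-homo : ∀ i j → fromℤ (i *ℤ j) ≈ fromℤ i * fromℤ j
  *-homo i j = begin
    fromℤ (sign i Sign.* sign j ◃ ∣ i ∣ *ℕ ∣ j ∣)
      ≈⟨ sign-◃-homo (sign i Sign.* sign j) (∣ i ∣ *ℕ ∣ j ∣) ⟩
    fromSign (sign i Sign.* sign j) * (∣ i ∣ *ℕ ∣ j ∣) × 1#
      ≈⟨ *-cong (sign-*-homo (sign i) (sign j)) (×1-homo-* ∣ i ∣ ∣ j ∣) ⟩
    (fromSign (sign i) * fromSign (sign j)) * (∣ i ∣ × 1# * ∣ j ∣ × 1#)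
      ≈⟨ *-interchange _ _ _ _ ⟩
    (fromSign (sign i) * ∣ i ∣ × 1#) * (fromSign (sign j) * ∣ j ∣ × 1#)
      ≈⟨ *-cong (sign-abs-homo i) (sign-abs-homo j) ⟨
    fromℤ i * fromℤ j
      ∎

  -‿homo : ∀ i → fromℤ (-ℤ i) ≈ - fromℤ i
  -‿homo (+ zero)  = sym -0#≈0#
  -‿homo (+ suc n) = refl
  -‿homo -[1+ n ]  = sym (-‿involutive _)

  homomorphism : CommutativeRing.rawRing ℤ.+-*-commutativeRing -Raw-AlmostCommutative⟶ fromCommutativeRing R
  homomorphism = record
    { ⟦_⟧ = fromℤ ; +-homo = +-homo ; *-homo = *-homo ; -‿homo = -‿homo ; 0-homo = refl ; 1-homo = refl }

  fromℤ-dec : ∀ i j → Maybe (fromℤ i ≈ fromℤ j)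
  fromℤ-dec i j with i ≟ℤ j
  ... | yes ≡.refl = just refl
  ... | no _       = nothing

  open import Algebra.Solver.Ring _ _ homomorphism fromℤ-dec public

data Offset (b : ℕ) : ℕ → Set where
  below  : ∀ {i} → i < b → Offset b i
  offset : ∀ t → Offset b (b +ℕ t)

offset? : ∀ b i → Offset b i
offset? zero    i       = offset i
offset? (suc b) zero    = below (s≤s z≤n)
offset? (suc b) (suc i) with offset? b i
... | below i<b = below (s≤s i<b)
... | offset t  = offset t

+[a+t]-+a≡+t : ∀ a t → + (a +ℕ t) -ℤ + a ≡ + t
+[a+t]-+a≡+t a t = ≡.trans (ℤ.m-n≡m⊖n (a +ℕ t) a) (≡.trans (ℤ.⊖-≥ (ℕ.m≤m+n a t)) (≡.cong +_ (ℕ.m+n∸m≡n a t)))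

+j-+[1+k]≡-[1+k∸j] : ∀ {j k} → j ≤ k → + j -ℤ + suc k ≡ -[1+ k ∸ j ]
+j-+[1+k]≡-[1+k∸j] {j} {k} j≤k = ≡.trans (ℤ.m-n≡m⊖n j (suc k)) (≡.trans (ℤ.⊖-< (s≤s j≤k)) (≡.cong (λ l → -ℤ (+ l)) (ℕ.+-∸-assoc 1 j≤k)))

[1+r]C2≡r+rC2 : ∀ r → suc r C 2 ≡ r +ℕ r C 2
[1+r]C2≡r+rC2 r = ≡.trans (≡.sym (nCk+nC[k+1]≡[n+1]C[k+1] r 1)) (≡.cong (_+ℕ r C 2) (nC1≡n r))

module FieldProperties {c ℓ : Level} (K : Field c ℓ) where
  open Field K
  open IntegerCoefficientSolver commutativeRing
  open import Relation.Binary.Reasoning.Setoid setoid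

  x*y*y⁻¹≈x : ∀ {y} x → ¬ y ≈ 0# → x * y * y ⁻¹ ≈ x
  x*y*y⁻¹≈x {y} x y≉0 = trans (*-assoc x y (y ⁻¹)) (trans (*-congˡ (⁻¹-inverse y y≉0)) (*-identityʳ x))

  *-cancelʳ : ∀ {u v w} → ¬ w ≈ 0# → u * w ≈ v * w → u ≈ v
  *-cancelʳ {u} {v} w≉0 uw≈vw = trans (sym (x*y*y⁻¹≈x u w≉0)) (trans (*-congʳ uw≈vw) (x*y*y⁻¹≈x v w≉0))

  *-nonzero : ∀ {u v} → ¬ u ≈ 0# → ¬ v ≈ 0# → ¬ u * v ≈ 0#
  *-nonzero {u} {v} u≉0 v≉0 uv≈0 = v≉0 (begin
    v              ≈⟨ x*y*y⁻¹≈x v u≉0 ⟨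
    v * u * u ⁻¹   ≈⟨ *-congʳ (trans (*-comm v u) uv≈0) ⟩
    0# * u ⁻¹      ≈⟨ zeroˡ _ ⟩
    0#             ∎)

  both-vanish : ∀ {h₁ h₀} u v w z → h₁ ≈ 0# → h₀ ≈ 0# → u * (h₁ + h₀) + v * h₁ + w * h₀ ≈ z * h₁
  both-vanish {h₁} {h₀} u v w z h₁≈0 h₀≈0 = begin
    u * (h₁ + h₀) + v * h₁ + w * h₀   ≈⟨ +-cong (+-cong (*-congˡ (+-cong h₁≈0 h₀≈0)) (*-congˡ h₁≈0)) (*-congˡ h₀≈0) ⟩
    u * (0# + 0#) + v * 0# + w * 0#   ≈⟨ solve 4 (λ u v w z → u :* (con (+ 0) :+ con (+ 0)) :+ v :* con (+ 0) :+ w :* con (+ 0)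
                                                  := z :* con (+ 0))
                                                 refl u v w z ⟩
    z * 0#                            ≈⟨ *-congˡ h₁≈0 ⟨
    z * h₁                            ∎

  ⁻¹-distrib-* : ∀ {u v} → ¬ u ≈ 0# → ¬ v ≈ 0# → (u * v) ⁻¹ ≈ u ⁻¹ * v ⁻¹
  ⁻¹-distrib-* {u} {v} u≉0 v≉0 = *-cancelʳ (*-nonzero u≉0 v≉0) (begin
    (u * v) ⁻¹ * (u * v)          ≈⟨ *-comm _ _ ⟩
    u * v * (u * v) ⁻¹            ≈⟨ ⁻¹-inverse _ (*-nonzero u≉0 v≉0) ⟩
    1#                            ≈⟨ *-identityˡ 1# ⟨
    1# * 1#                       ≈⟨ *-cong (⁻¹-inverse u u≉0) (⁻¹-inverse v v≉0) ⟨
    u * u ⁻¹ * (v * v ⁻¹)         ≈⟨ solve 4 (λ u u⁻ v v⁻ → u :* u⁻ :* (v :* v⁻) := u⁻ :* v⁻ :* (u :* v)) refl u (u ⁻¹) v (v ⁻¹) ⟩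
    u ⁻¹ * v ⁻¹ * (u * v)         ∎)

  -- binom has the shape of Fbin and qbin, so that for (F, Ffact) and (qint, qfact) it is
  -- definitionally Fbin n r and qbin n (+ r).
  module FactorialBinomial (f fact : ℕ → Carrier) (fact-zero : fact 0 ≡ 1#) (fact-suc : ∀ n → fact (suc n) ≡ fact n * f (suc n))
                            (f≉0 : ∀ n → ¬ f (suc n) ≈ 0#) where

    fact≉0 : ∀ n → ¬ fact n ≈ 0#
    fact≉0 zero    fact0≈0 = 0≉1 (trans (sym fact0≈0) (reflexive fact-zero))
    fact≉0 (suc n) fact[1+n]≈0 = *-nonzero (fact≉0 n) (f≉0 n) (trans (reflexive (≡.sym (fact-suc n))) fact[1+n]≈0)

    binom : ℕ → ℕ → Carrier
    binom n r = if r ≤ᵇ n then fact n * ((fact r * fact (n ∸ r)) ⁻¹) else 0#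

    binom-≤ : ∀ {n r} → r ≤ n → binom n r ≡ fact n * ((fact r * fact (n ∸ r)) ⁻¹)
    binom-≤ {n} {r} r≤n with r ≤ᵇ n | ℕ.≤ᵇ-reflects-≤ r n
    ... | true  | _           = ≡.refl
    ... | false | ofⁿ r≰n     = ⊥-elim (r≰n r≤n)

    binom-> : ∀ {n r} → n < r → binom n r ≡ 0#
    binom-> {n} {r} n<r with r ≤ᵇ n | ℕ.≤ᵇ-reflects-≤ r n
    ... | false | _           = ≡.refl
    ... | true  | ofʸ r≤n     = ⊥-elim (ℕ.<⇒≱ n<r r≤n)

    binom-*-facts : ∀ {n r} → r ≤ n → binom n r * (fact r * fact (n ∸ r)) ≈ fact n
    binom-*-facts {n} {r} r≤n = begin
      binom n r * (fact r * fact (n ∸ r))                                   ≡⟨ ≡.cong (_* _) (binom-≤ r≤n) ⟩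
      fact n * ((fact r * fact (n ∸ r)) ⁻¹) * (fact r * fact (n ∸ r))       ≈⟨ *-assoc _ _ _ ⟩
      fact n * ((fact r * fact (n ∸ r)) ⁻¹ * (fact r * fact (n ∸ r)))       ≈⟨ *-congˡ (trans (*-comm _ _) (⁻¹-inverse _ (*-nonzero (fact≉0 r) (fact≉0 (n ∸ r))))) ⟩
      fact n * 1#                                                           ≈⟨ *-identityʳ _ ⟩
      fact n                                                                ∎

    binom-+-*-facts : ∀ r t → binom (r +ℕ t) r * (fact r * fact t) ≈ fact (r +ℕ t)
    binom-+-*-facts r t = begin
      binom (r +ℕ t) r * (fact r * fact t)                ≡⟨ ≡.cong (λ l → binom (r +ℕ t) r * (fact r * fact l)) (ℕ.m+n∸m≡n r t) ⟨
      binom (r +ℕ t) r * (fact r * fact (r +ℕ t ∸ r))     ≈⟨ binom-*-facts (ℕ.m≤m+n r t) ⟩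
      fact (r +ℕ t)                                       ∎

    fact-*-binom-+ : ∀ r t → fact (suc t) * binom (r +ℕ suc t) r ≈ f (suc (r +ℕ t)) * (fact t * binom (r +ℕ t) r)
    fact-*-binom-+ r t = *-cancelʳ (fact≉0 r) (begin
      fact (suc t) * binom (r +ℕ suc t) r * fact r        ≈⟨ solve 3 (λ a b c → a :* b :* c := b :* (c :* a)) refl _ _ _ ⟩
      binom (r +ℕ suc t) r * (fact r * fact (suc t))      ≈⟨ binom-+-*-facts r (suc t) ⟩
      fact (r +ℕ suc t)                                   ≡⟨ ≡.cong fact (ℕ.+-suc r t) ⟩
      fact (suc (r +ℕ t))                                 ≡⟨ fact-suc (r +ℕ t) ⟩
      fact (r +ℕ t) * f (suc (r +ℕ t))                    ≈⟨ *-congʳ (binom-+-*-facts r t) ⟨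
      binom (r +ℕ t) r * (fact r * fact t) * f (suc (r +ℕ t))
        ≈⟨ solve 4 (λ a b c d → a :* (b :* c) :* d := d :* (c :* a) :* b) refl _ _ _ _ ⟩
      f (suc (r +ℕ t)) * (fact t * binom (r +ℕ t) r) * fact r ∎)

    binom-suc-ratio : ∀ {n r} → r < n → f (suc r) * binom n (suc r) ≈ f (n ∸ r) * binom n r
    binom-suc-ratio {n} {r} r<n = *-cancelʳ (*-nonzero (fact≉0 (suc r)) (fact≉0 (n ∸ r))) (begin
      f (suc r) * binom n (suc r) * (fact (suc r) * fact (n ∸ r))
        ≡⟨ ≡.cong (λ l → f (suc r) * binom n (suc r) * (fact (suc r) * fact l)) n∸r≡1+[n∸1+r] ⟩
      f (suc r) * binom n (suc r) * (fact (suc r) * fact (suc (n ∸ suc r)))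
        ≡⟨ ≡.cong (λ l → f (suc r) * binom n (suc r) * (fact (suc r) * l)) (fact-suc (n ∸ suc r)) ⟩
      f (suc r) * binom n (suc r) * (fact (suc r) * (fact (n ∸ suc r) * f (suc (n ∸ suc r))))
        ≈⟨ solve 5 (λ a b c d e → a :* b :* (c :* (d :* e)) := a :* e :* (b :* (c :* d))) refl _ _ _ _ _ ⟩
      f (suc r) * f (suc (n ∸ suc r)) * (binom n (suc r) * (fact (suc r) * fact (n ∸ suc r)))
        ≈⟨ *-congˡ (binom-*-facts r<n) ⟩
      f (suc r) * f (suc (n ∸ suc r)) * fact n
        ≡⟨ ≡.cong (λ l → f (suc r) * f l * fact n) (≡.sym n∸r≡1+[n∸1+r]) ⟩
      f (suc r) * f (n ∸ r) * fact n
        ≈⟨ *-congˡ (binom-*-facts (ℕ.<⇒≤ r<n)) ⟨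
      f (suc r) * f (n ∸ r) * (binom n r * (fact r * fact (n ∸ r)))
        ≈⟨ solve 5 (λ a b c d e → a :* b :* (c :* (d :* e)) := b :* c :* (d :* a :* e)) refl _ _ _ _ _ ⟩
      f (n ∸ r) * binom n r * (fact r * f (suc r) * fact (n ∸ r))
        ≡⟨ ≡.cong (λ l → f (n ∸ r) * binom n r * (l * fact (n ∸ r))) (≡.sym (fact-suc r)) ⟩
      f (n ∸ r) * binom n r * (fact (suc r) * fact (n ∸ r)) ∎)
      where
      n∸r≡1+[n∸1+r] : n ∸ r ≡ suc (n ∸ suc r)
      n∸r≡1+[n∸1+r] = ℕ.+-∸-assoc 1 r<n

data Block (m n : ℕ) : Fin (m +ℕ n) → Set where
  left  : (i : Fin m) → Block m n (i ↑ˡ n)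
  right : (j : Fin n) → Block m n (m ↑ʳ j)

block : ∀ m n (i : Fin (m +ℕ n)) → Block m n i
block zero    n i        = right i
block (suc m) n fzero    = left fzero
block (suc m) n (fsuc i) with block m n i
... | left i′  = left (fsuc i′)
... | right j  = right j

module _ {c ℓ : Level} (K : Field c ℓ) (q : Field.Carrier K) (F : ℕ → Field.Carrier K) (x a : Field.Carrier K) where
  open Field K
  open Construction K q F x a
  open FieldProperties K
  open IntegerCoefficientSolver commutativeRing
  open import Relation.Binary.Reasoning.Setoid setoid

  pow-+ : ∀ u m n → pow u (m +ℕ n) ≈ pow u m * pow u n
  pow-+ u zero    n = sym (*-identityˡ _)
  pow-+ u (suc m) n = trans (*-congˡ (pow-+ u m n)) (sym (*-assoc _ _ _))

  pow-*-pow-⁻¹ : ∀ {u} n → ¬ u ≈ 0# → pow u n * pow (u ⁻¹) n ≈ 1#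
  pow-*-pow-⁻¹ zero    _ = *-identityˡ 1#
  pow-*-pow-⁻¹ {u} (suc n) u≉0 = begin
    u * pow u n * (u ⁻¹ * pow (u ⁻¹) n)  ≈⟨ solve 4 (λ a b c d → a :* b :* (c :* d) := a :* c :* (b :* d)) refl _ _ _ _ ⟩
    u * u ⁻¹ * (pow u n * pow (u ⁻¹) n)  ≈⟨ *-cong (⁻¹-inverse u u≉0) (pow-*-pow-⁻¹ n u≉0) ⟩
    1# * 1#                              ≈⟨ *-identityˡ 1# ⟩
    1#                                   ∎

  qint-+ : ∀ m n → qint (m +ℕ n) ≈ qint m + pow q m * qint n
  qint-+ zero    n = sym (trans (+-identityˡ _) (*-identityˡ _))
  qint-+ (suc m) n = begin
    1# + q * qint (m +ℕ n)                    ≈⟨ +-congˡ (*-congˡ (qint-+ m n)) ⟩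
    1# + q * (qint m + pow q m * qint n)      ≈⟨ solve 4 (λ q a b c → con (+ 1) :+ q :* (a :+ b :* c) := con (+ 1) :+ q :* a :+ q :* b :* c) refl q _ _ _ ⟩
    1# + q * qint m + q * pow q m * qint n    ∎

  qpow-neg : ∀ n → qpow (-ℤ (+ n)) ≡ pow (q ⁻¹) n
  qpow-neg zero    = ≡.refl
  qpow-neg (suc n) = ≡.refl

  ∑-cong : ∀ n {f g : Fin n → Carrier} → (∀ i → f i ≈ g i) → ∑ n f ≈ ∑ n g
  ∑-cong zero    f≈g = refl
  ∑-cong (suc n) f≈g = +-cong (f≈g fzero) (∑-cong n (λ i → f≈g (fsuc i)))

  ∑-zero : ∀ n {f : Fin n → Carrier} → (∀ i → f i ≈ 0#) → ∑ n f ≈ 0#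
  ∑-zero zero    f≈0 = refl
  ∑-zero (suc n) f≈0 = trans (+-cong (f≈0 fzero) (∑-zero n (λ i → f≈0 (fsuc i)))) (+-identityʳ 0#)

  ∑-+ : ∀ n (f g : Fin n → Carrier) → ∑ n (λ i → f i + g i) ≈ ∑ n f + ∑ n g
  ∑-+ zero    f g = sym (+-identityʳ 0#)
  ∑-+ (suc n) f g = trans (+-congˡ (∑-+ n _ _))
    (solve 4 (λ a b c d → (a :+ b) :+ (c :+ d) := (a :+ c) :+ (b :+ d)) refl (f fzero) (g fzero) _ _)

  ∑-split : ∀ m n (f : Fin (m +ℕ n) → Carrier) → ∑ (m +ℕ n) f ≈ ∑ m (λ i → f (i ↑ˡ n)) + ∑ n (λ j → f (m ↑ʳ j))
  ∑-split zero    n f = sym (+-identityˡ _)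
  ∑-split (suc m) n f = trans (+-congˡ (∑-split m n (λ i → f (fsuc i)))) (sym (+-assoc _ _ _))

  ∑-δ : ∀ L (g : ℕ → Carrier) {J} → J ≤ L → g L ≈ 0# → ∑ L (λ i → g (toℕ i) * δ (toℕ i) J) ≈ g J
  ∑-δ zero    g z≤n     g0≈0 = sym g0≈0
  ∑-δ (suc L) g {zero}  _ _ = begin
    g 0 * 1# + ∑ L (λ i → g (suc (toℕ i)) * 0#)   ≈⟨ +-cong (*-identityʳ _) (∑-zero L (λ i → zeroʳ _)) ⟩
    g 0 + 0#                                       ≈⟨ +-identityʳ _ ⟩
    g 0                                            ∎
  ∑-δ (suc L) g {suc J} (s≤s J≤L) gL≈0 = begin
    g 0 * 0# + ∑ L (λ i → g (suc (toℕ i)) * δ (toℕ i) J)   ≈⟨ +-cong (zeroʳ _) (∑-δ L (λ i → g (suc i)) J≤L gL≈0) ⟩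
    0# + g (suc J)                                          ≈⟨ +-identityˡ _ ⟩
    g (suc J)                                               ∎

  ∑-bidiagonal : ∀ L (y d e : ℕ → Carrier) {J} → J ≤ L → y 0 ≈ 0# → y (suc L) ≈ 0# →
    ∑ L (λ i → y (suc (toℕ i)) * (d (toℕ i) * δ (toℕ i) J + e (toℕ i) * δ (suc (toℕ i)) J))
      ≈ d J * y (suc J) + e (J ∸ 1) * y J
  ∑-bidiagonal L y d e {J} J≤L y0≈0 y[1+L]≈0 = begin
    ∑ L (λ i → y (suc (toℕ i)) * (d (toℕ i) * δ (toℕ i) J + e (toℕ i) * δ (suc (toℕ i)) J))
      ≈⟨ ∑-cong L (λ i → solve 5 (λ y d δ₀ e δ₁ → y :* (d :* δ₀ :+ e :* δ₁) := d :* y :* δ₀ :+ e :* y :* δ₁) refl _ _ _ _ _) ⟩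
    ∑ L (λ i → d (toℕ i) * y (suc (toℕ i)) * δ (toℕ i) J + e (toℕ i) * y (suc (toℕ i)) * δ (suc (toℕ i)) J)
      ≈⟨ ∑-+ L _ _ ⟩
    ∑ L (λ i → d (toℕ i) * y (suc (toℕ i)) * δ (toℕ i) J) + ∑ L (λ i → e (toℕ i) * y (suc (toℕ i)) * δ (suc (toℕ i)) J)
      ≈⟨ +-cong (∑-δ L (λ i → d i * y (suc i)) J≤L (vanishes (d L))) (subdiagonal J J≤L) ⟩
    d J * y (suc J) + e (J ∸ 1) * y J
      ∎
    where
    vanishes : ∀ u → u * y (suc L) ≈ 0#
    vanishes u = trans (*-congˡ y[1+L]≈0) (zeroʳ u)
    subdiagonal : ∀ J → J ≤ L → ∑ L (λ i → e (toℕ i) * y (suc (toℕ i)) * δ (suc (toℕ i)) J) ≈ e (J ∸ 1) * y J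
    subdiagonal zero    _     = trans (∑-zero L (λ i → zeroʳ _)) (sym (trans (*-congˡ y0≈0) (zeroʳ _)))
    subdiagonal (suc J) 1+J≤L = ∑-δ L (λ i → e i * y (suc i)) (ℕ.<⇒≤ 1+J≤L) (vanishes (e L))

  X-↑ˡ : ∀ m k n (r : Fin (T (suc n))) → X m k (suc n) (r ↑ˡ suc (suc n)) ≡ X m k n r
  X-↑ˡ m k n r rewrite Fin.splitAt-↑ˡ (T (suc n)) r (suc (suc n)) = ≡.refl

  X-↑ʳ : ∀ m k n (j : Fin (suc (suc n))) → X m k (suc n) (T (suc n) ↑ʳ j) ≡ Xe m k (suc (suc n)) (suc (toℕ j))
  X-↑ʳ m k n j rewrite Fin.splitAt-↑ʳ (T (suc n)) (suc (suc n)) j = ≡.refl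

  X-last : ∀ m k n (i : Fin (suc n)) → X m k n (T n ↑ʳ i) ≡ Xe m k (suc n) (suc (toℕ i))
  X-last m k zero    fzero = ≡.refl
  X-last m k (suc n) i     = X-↑ʳ m k n i

  N-↑ˡ-↑ˡ : ∀ n (r c : Fin (T (suc n))) → N (suc n) (r ↑ˡ suc (suc n)) (c ↑ˡ suc (suc n)) ≡ N n r c
  N-↑ˡ-↑ˡ n r c rewrite Fin.splitAt-↑ˡ (T (suc n)) r (suc (suc n)) | Fin.splitAt-↑ˡ (T (suc n)) c (suc (suc n)) = ≡.refl

  N-↑ˡ-↑ʳ : ∀ n (r : Fin (T (suc n))) (j : Fin (suc (suc n))) → N (suc n) (r ↑ˡ suc (suc n)) (T (suc n) ↑ʳ j) ≡ Nbar n r j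
  N-↑ˡ-↑ʳ n r j rewrite Fin.splitAt-↑ˡ (T (suc n)) r (suc (suc n)) | Fin.splitAt-↑ʳ (T (suc n)) (suc (suc n)) j = ≡.refl

  N-↑ʳ-↑ˡ : ∀ n (i : Fin (suc (suc n))) (c : Fin (T (suc n))) → N (suc n) (T (suc n) ↑ʳ i) (c ↑ˡ suc (suc n)) ≡ 0#
  N-↑ʳ-↑ˡ n i c rewrite Fin.splitAt-↑ʳ (T (suc n)) (suc (suc n)) i | Fin.splitAt-↑ˡ (T (suc n)) c (suc (suc n)) = ≡.refl

  N-↑ʳ-↑ʳ : ∀ n (i j : Fin (suc (suc n))) → N (suc n) (T (suc n) ↑ʳ i) (T (suc n) ↑ʳ j) ≡ Nhat n i j
  N-↑ʳ-↑ʳ n i j rewrite Fin.splitAt-↑ʳ (T (suc n)) (suc (suc n)) i | Fin.splitAt-↑ʳ (T (suc n)) (suc (suc n)) j = ≡.refl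

  Nbar-↑ˡ : ∀ n (r : Fin (T n)) (j : Fin (suc (suc n))) → Nbar n (r ↑ˡ suc n) j ≡ 0#
  Nbar-↑ˡ n r j rewrite Fin.splitAt-↑ˡ (T n) r (suc n) = ≡.refl

  Nbar-↑ʳ : ∀ n (i : Fin (suc n)) (j : Fin (suc (suc n))) →
            Nbar n (T n ↑ʳ i) j ≡ - (a * F (suc n) * (δ (toℕ i) (toℕ j) + δ (suc (toℕ i)) (toℕ j)))
  Nbar-↑ʳ n i j rewrite Fin.splitAt-↑ʳ (T n) (suc n) i = ≡.refl

  rowMul-↑ˡ : ∀ m k n (c : Fin (T (suc n))) →
              rowMul (T (suc (suc n))) (X m k (suc n)) (N (suc n)) (c ↑ˡ suc (suc n)) ≈ rowMul (T (suc n)) (X m k n) (N n) c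
  rowMul-↑ˡ m k n c = begin
    ∑ (T (suc n) +ℕ suc (suc n)) (λ r → X m k (suc n) r * N (suc n) r (c ↑ˡ suc (suc n)))
      ≈⟨ ∑-split (T (suc n)) (suc (suc n)) _ ⟩
    ∑ (T (suc n)) (λ r → X m k (suc n) (r ↑ˡ suc (suc n)) * N (suc n) (r ↑ˡ suc (suc n)) (c ↑ˡ suc (suc n)))
      + ∑ (suc (suc n)) (λ i → X m k (suc n) (T (suc n) ↑ʳ i) * N (suc n) (T (suc n) ↑ʳ i) (c ↑ˡ suc (suc n)))
      ≈⟨ +-cong (∑-cong (T (suc n)) (λ r → reflexive (≡.cong₂ _*_ (X-↑ˡ m k n r) (N-↑ˡ-↑ˡ n r c))))
                (∑-zero (suc (suc n)) {f = λ i → X m k (suc n) (T (suc n) ↑ʳ i) * N (suc n) (T (suc n) ↑ʳ i) (c ↑ˡ suc (suc n))}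
                        (λ i → trans (*-congˡ (reflexive (N-↑ʳ-↑ˡ n i c))) (zeroʳ _))) ⟩
    rowMul (T (suc n)) (X m k n) (N n) c + 0#
      ≈⟨ +-identityʳ _ ⟩
    rowMul (T (suc n)) (X m k n) (N n) c
      ∎

  rowMul-↑ʳ : ∀ m k n (j : Fin (suc (suc n))) →
              rowMul (T (suc (suc n))) (X m k (suc n)) (N (suc n)) (T (suc n) ↑ʳ j)
                ≈ ∑ (suc n) (λ i → Xe m k (suc n) (suc (toℕ i)) * - (a * F (suc n) * (δ (toℕ i) (toℕ j) + δ (suc (toℕ i)) (toℕ j))))
                  + ∑ (suc (suc n)) (λ i → Xe m k (suc (suc n)) (suc (toℕ i)) * Nhat n i j)
  rowMul-↑ʳ m k n j = begin
    ∑ (T (suc n) +ℕ suc (suc n)) (λ r → X m k (suc n) r * N (suc n) r (T (suc n) ↑ʳ j))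
      ≈⟨ ∑-split (T (suc n)) (suc (suc n)) _ ⟩
    ∑ (T (suc n)) (λ r → X m k (suc n) (r ↑ˡ suc (suc n)) * N (suc n) (r ↑ˡ suc (suc n)) (T (suc n) ↑ʳ j))
      + ∑ (suc (suc n)) (λ i → X m k (suc n) (T (suc n) ↑ʳ i) * N (suc n) (T (suc n) ↑ʳ i) (T (suc n) ↑ʳ j))
      ≈⟨ +-cong (∑-cong (T (suc n)) (λ r → reflexive (≡.cong₂ _*_ (X-↑ˡ m k n r) (N-↑ˡ-↑ʳ n r j))))
                (∑-cong (suc (suc n)) (λ i → reflexive (≡.cong₂ _*_ (X-↑ʳ m k n i) (N-↑ʳ-↑ʳ n i j)))) ⟩
    ∑ (T n +ℕ suc n) (λ r → X m k n r * Nbar n r j) + ∑ (suc (suc n)) (λ i → Xe m k (suc (suc n)) (suc (toℕ i)) * Nhat n i j)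
      ≈⟨ +-congʳ (∑-split (T n) (suc n) _) ⟩
    ∑ (T n) (λ r → X m k n (r ↑ˡ suc n) * Nbar n (r ↑ˡ suc n) j) + ∑ (suc n) (λ i → X m k n (T n ↑ʳ i) * Nbar n (T n ↑ʳ i) j)
      + ∑ (suc (suc n)) (λ i → Xe m k (suc (suc n)) (suc (toℕ i)) * Nhat n i j)
      ≈⟨ +-congʳ (+-cong (∑-zero (T n) (λ r → trans (*-congˡ (reflexive (Nbar-↑ˡ n r j))) (zeroʳ _)))
                         (∑-cong (suc n) (λ i → reflexive (≡.cong₂ _*_ (X-last m k n i) (Nbar-↑ʳ n i j))))) ⟩
    0# + ∑ (suc n) (λ i → Xe m k (suc n) (suc (toℕ i)) * - (a * F (suc n) * (δ (toℕ i) (toℕ j) + δ (suc (toℕ i)) (toℕ j))))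
      + ∑ (suc (suc n)) (λ i → Xe m k (suc (suc n)) (suc (toℕ i)) * Nhat n i j)
      ≈⟨ +-congʳ (+-identityˡ _) ⟩
    ∑ (suc n) (λ i → Xe m k (suc n) (suc (toℕ i)) * - (a * F (suc n) * (δ (toℕ i) (toℕ j) + δ (suc (toℕ i)) (toℕ j))))
      + ∑ (suc (suc n)) (λ i → Xe m k (suc (suc n)) (suc (toℕ i)) * Nhat n i j)
      ∎

  module _ (q≉0 : ¬ q ≈ 0#) where

    qpow-suc : ∀ z → qpow (sucℤ z) ≈ q * qpow z
    qpow-suc (+ n)        = refl
    qpow-suc -[1+ zero ]  = sym (trans (*-congˡ (*-identityʳ _)) (⁻¹-inverse q q≉0))
    qpow-suc -[1+ suc n ] = begin
      q ⁻¹ * pow (q ⁻¹) n                   ≈⟨ *-identityˡ _ ⟨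
      1# * (q ⁻¹ * pow (q ⁻¹) n)            ≈⟨ *-congʳ (⁻¹-inverse q q≉0) ⟨
      q * q ⁻¹ * (q ⁻¹ * pow (q ⁻¹) n)      ≈⟨ *-assoc _ _ _ ⟩
      q * (q ⁻¹ * (q ⁻¹ * pow (q ⁻¹) n))    ∎

    qpow-+-pow : ∀ z n → qpow (z +ℤ + n) ≈ qpow z * pow q n
    qpow-+-pow z zero    = trans (reflexive (≡.cong qpow (ℤ.+-identityʳ z))) (sym (*-identityʳ _))
    qpow-+-pow z (suc n) = begin
      qpow (z +ℤ + suc n)       ≡⟨ ≡.cong qpow (x∙yz≈y∙xz z (+ 1) (+ n)) ⟩
      qpow (sucℤ (z +ℤ + n))    ≈⟨ qpow-suc (z +ℤ + n) ⟩
      q * qpow (z +ℤ + n)       ≈⟨ *-congˡ (qpow-+-pow z n) ⟩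
      q * (qpow z * pow q n)    ≈⟨ solve 3 (λ q a b → q :* (a :* b) := a :* (q :* b)) refl q _ _ ⟩
      qpow z * (q * pow q n)    ∎
      where open import Algebra.Properties.CommutativeSemigroup ℤ.+-commutativeSemigroup using (x∙yz≈y∙xz)

    qpow-+-choose2 : ∀ z w → qpow (z +ℤ choose2 w) ≈ qpow z * qpow (choose2 w)
    qpow-+-choose2 z (+ n)    = qpow-+-pow z (n C 2)
    qpow-+-choose2 z -[1+ n ] = qpow-+-pow z (suc (suc n) C 2)

  module _ ([i]≉0 : ∀ i → ¬ qint (suc i) ≈ 0#) where
    private module QB = FactorialBinomial qint qfact ≡.refl (λ _ → ≡.refl) [i]≉0

    -- the coefficient of z^r in ∏_{i<m} (1 + q^i z)
    gaussCoeff : ℕ → ℕ → Carrier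
    gaussCoeff m r = pow q (r C 2) * qbin m (+ r)

    gaussCoeff-vanishes : ∀ {m r} → m < r → gaussCoeff m r ≈ 0#
    gaussCoeff-vanishes m<r = trans (*-congˡ (reflexive (QB.binom-> m<r))) (zeroʳ _)

    gaussCoeff-recurrence : ∀ m r → qint (suc r) * gaussCoeff m (suc r) ≈ pow q r * qint (m ∸ r) * gaussCoeff m r
    gaussCoeff-recurrence m r with r ℕ.<? m
    ... | yes r<m = begin
      qint (suc r) * (pow q (suc r C 2) * qbin m (+ suc r))
        ≈⟨ *-congˡ (*-congʳ (trans (reflexive (≡.cong (pow q) ([1+r]C2≡r+rC2 r))) (pow-+ q r (r C 2)))) ⟩
      qint (suc r) * (pow q r * pow q (r C 2) * qbin m (+ suc r))
        ≈⟨ solve 4 (λ a b c d → a :* (b :* c :* d) := b :* c :* (a :* d)) refl _ _ _ _ ⟩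
      pow q r * pow q (r C 2) * (qint (suc r) * qbin m (+ suc r))
        ≈⟨ *-congˡ (QB.binom-suc-ratio r<m) ⟩
      pow q r * pow q (r C 2) * (qint (m ∸ r) * qbin m (+ r))
        ≈⟨ solve 4 (λ a b c d → a :* b :* (c :* d) := a :* c :* (b :* d)) refl _ _ _ _ ⟩
      pow q r * qint (m ∸ r) * (pow q (r C 2) * qbin m (+ r))
        ∎
    ... | no r≮m = begin
      qint (suc r) * gaussCoeff m (suc r)     ≈⟨ *-congˡ (gaussCoeff-vanishes (s≤s (ℕ.≮⇒≥ r≮m))) ⟩
      qint (suc r) * 0#                       ≈⟨ zeroʳ _ ⟩
      0#                                      ≈⟨ zeroˡ _ ⟨
      0# * gaussCoeff m r                     ≈⟨ *-congʳ (zeroʳ _) ⟨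
      pow q r * qint 0 * gaussCoeff m r       ≡⟨ ≡.cong (λ l → pow q r * qint l * gaussCoeff m r) (ℕ.m≤n⇒m∸n≡0 (ℕ.≮⇒≥ r≮m)) ⟨
      pow q r * qint (m ∸ r) * gaussCoeff m r ∎

    gaussCoeff-eigen : ∀ m t r →
      - (qint t * pow q m) * (gaussCoeff m (suc r) + gaussCoeff m r)
        + pow q (suc r) * qint (m +ℕ t ∸ suc r) * gaussCoeff m (suc r)
        + pow q r * qint (m +ℕ t ∸ r) * gaussCoeff m r
      ≈ qint m * gaussCoeff m (suc r)
    gaussCoeff-eigen m t r with compare r m
    ... | greater m u = both-vanish _ _ _ _ (gaussCoeff-vanishes (ℕ.m<n⇒m<1+n m<r)) (gaussCoeff-vanishes m<r)
      where
      m<r : m < suc (m +ℕ u)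
      m<r = s≤s (ℕ.m≤m+n m u)
    ... | equal r = begin
      - (qint t * pow q r) * (H₁ + H₀) + pow q (suc r) * qint (r +ℕ t ∸ suc r) * H₁ + pow q r * qint (r +ℕ t ∸ r) * H₀
        ≈⟨ +-cong (+-cong (*-congˡ (+-congʳ H₁≈0)) (*-congˡ H₁≈0)) (*-congʳ (*-congˡ (reflexive (≡.cong qint (ℕ.m+n∸m≡n r t))))) ⟩
      - (qint t * pow q r) * (0# + H₀) + pow q (suc r) * qint (r +ℕ t ∸ suc r) * 0# + pow q r * qint t * H₀
        ≈⟨ solve 6 (λ a b c d e f → :- (a :* b) :* (con (+ 0) :+ f) :+ c :* d :* con (+ 0) :+ b :* a :* f := e :* con (+ 0))
                   refl (qint t) (pow q r) (pow q (suc r)) (qint (r +ℕ t ∸ suc r)) (qint r) H₀ ⟩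
      qint r * 0#
        ≈⟨ *-congˡ H₁≈0 ⟨
      qint r * H₁
        ∎
      where
      H₁ H₀ : Carrier
      H₁ = gaussCoeff r (suc r)
      H₀ = gaussCoeff r r
      H₁≈0 : H₁ ≈ 0#
      H₁≈0 = gaussCoeff-vanishes (ℕ.n<1+n r)
    ... | less r u = begin
      - (Tt * pow q m) * (H₁ + H₀) + pow q (suc r) * qint (m +ℕ t ∸ suc r) * H₁ + pow q r * qint (m +ℕ t ∸ r) * H₀
        ≡⟨ ≡.cong₂ (λ i j → - (Tt * pow q m) * (H₁ + H₀) + pow q (suc r) * qint i * H₁ + pow q r * qint j * H₀)
                   [m+t]∸[1+r]≡u+t [m+t]∸r≡1+u+t ⟩
      - (Tt * (q * pow q (r +ℕ u))) * (H₁ + H₀) + q * pow q r * qint (u +ℕ t) * H₁ + pow q r * (1# + q * qint (u +ℕ t)) * H₀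
        ≈⟨ +-cong (+-cong (*-congʳ (-‿cong (*-congˡ (*-congˡ (pow-+ q r u))))) (*-congʳ (*-congˡ (qint-+ u t))))
                  (*-congʳ (*-congˡ (+-congˡ (*-congˡ (qint-+ u t))))) ⟩
      - (Tt * (q * (pow q r * pow q u))) * (H₁ + H₀) + q * pow q r * (U + pow q u * Tt) * H₁
        + pow q r * (1# + q * (U + pow q u * Tt)) * H₀
        ≈⟨ solve 7 (λ Tt q Pr Pu U H₁ H₀ →
              :- (Tt :* (q :* (Pr :* Pu))) :* (H₁ :+ H₀) :+ q :* Pr :* (U :+ Pu :* Tt) :* H₁
                :+ Pr :* (con (+ 1) :+ q :* (U :+ Pu :* Tt)) :* H₀
              := q :* Pr :* U :* H₁ :+ Pr :* (con (+ 1) :+ q :* U) :* H₀)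
            refl Tt q (pow q r) (pow q u) U H₁ H₀ ⟩
      q * pow q r * U * H₁ + pow q r * qint (suc u) * H₀
        ≡⟨ ≡.cong (λ i → q * pow q r * U * H₁ + pow q r * qint i * H₀) m∸r≡1+u ⟨
      q * pow q r * U * H₁ + pow q r * qint (m ∸ r) * H₀
        ≈⟨ +-congˡ (gaussCoeff-recurrence m r) ⟨
      q * pow q r * U * H₁ + (1# + q * qint r) * H₁
        ≈⟨ solve 5 (λ q Pr U R H₁ → q :* Pr :* U :* H₁ :+ (con (+ 1) :+ q :* R) :* H₁ := (con (+ 1) :+ q :* (R :+ Pr :* U)) :* H₁)
                   refl q (pow q r) U (qint r) H₁ ⟩
      (1# + q * (qint r + pow q r * U)) * H₁
        ≈⟨ *-congʳ (+-congˡ (*-congˡ (qint-+ r u))) ⟨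
      qint m * H₁
        ∎
      where
      Tt U H₁ H₀ : Carrier
      Tt = qint t
      U = qint u
      H₁ = gaussCoeff m (suc r)
      H₀ = gaussCoeff m r
      [m+t]∸[1+r]≡u+t : m +ℕ t ∸ suc r ≡ u +ℕ t
      [m+t]∸[1+r]≡u+t = ≡.trans (≡.cong (_∸ r) (ℕ.+-assoc r u t)) (ℕ.m+n∸m≡n r (u +ℕ t))
      [m+t]∸r≡1+u+t : m +ℕ t ∸ r ≡ suc (u +ℕ t)
      [m+t]∸r≡1+u+t = ≡.trans (≡.cong (_∸ r) (≡.trans (≡.cong suc (ℕ.+-assoc r u t)) (≡.sym (ℕ.+-suc r (u +ℕ t))))) (ℕ.m+n∸m≡n r (suc (u +ℕ t)))
      m∸r≡1+u : m ∸ r ≡ suc u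
      m∸r≡1+u = ≡.trans (≡.cong (_∸ r) (≡.sym (ℕ.+-suc r u))) (ℕ.m+n∸m≡n r (suc u))

    module _ (q≉0 : ¬ q ≈ 0#) (F≉0 : ∀ i → ¬ F (suc i) ≈ 0#) (m′ k′ : ℕ) where
      private module FB = FactorialBinomial F Ffact ≡.refl (λ _ → ≡.refl) F≉0

      m k s : ℕ
      m = suc m′
      k = suc k′
      s = m′ +ℕ k

      μ : Carrier
      μ = x - a * pow q k′ * qint m

      rowFactor : ℕ → Carrier
      rowFactor i = pow (- 1#) (i +ℕ m +ℕ k) * qpow (-ℤ (+ s *ℤ (+ i -ℤ + (m +ℕ k))))
                    * Ffactℤ (+ i -ℤ + (m +ℕ k)) * (qfactℤ (+ i -ℤ + (m +ℕ k)) ⁻¹) * Fbin (i ∸ 1) s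

      columnFactor : ℕ → Carrier
      columnFactor j = qpow (choose2 (+ j -ℤ + k)) * qbin m (+ j -ℤ + k)

      Xe-factorises : ∀ i j → Xe m k i j ≈ a * rowFactor i * columnFactor j
      Xe-factorises i j = begin
        σ * a * qpow (A +ℤ choose2 B) * Ff * Qf * Fb * Qb
          ≈⟨ *-congʳ (*-congʳ (*-congʳ (*-congʳ (*-congˡ (qpow-+-choose2 q≉0 A B))))) ⟩
        σ * a * (qpow A * qpow (choose2 B)) * Ff * Qf * Fb * Qb
          ≈⟨ solve 8 (λ σ a P P′ Ff Qf Fb Qb → σ :* a :* (P :* P′) :* Ff :* Qf :* Fb :* Qb := a :* (σ :* P :* Ff :* Qf :* Fb) :* (P′ :* Qb))
                     refl σ a (qpow A) (qpow (choose2 B)) Ff Qf Fb Qb ⟩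
        a * rowFactor i * columnFactor j
          ∎
        where
        A B : ℤ
        A = -ℤ (+ s *ℤ (+ i -ℤ + (m +ℕ k)))
        B = + j -ℤ + k
        σ Ff Qf Fb Qb : Carrier
        σ = pow (- 1#) (i +ℕ m +ℕ k)
        Ff = Ffactℤ (+ i -ℤ + (m +ℕ k))
        Qf = qfactℤ (+ i -ℤ + (m +ℕ k)) ⁻¹
        Fb = Fbin (i ∸ 1) s
        Qb = qbin m B

      rowFactor-below : ∀ {n} → n < s → rowFactor (suc n) ≈ 0#
      rowFactor-below n<s = trans (*-congˡ (reflexive (FB.binom-> n<s))) (zeroʳ _)

      rowFactor-offset : ∀ t → rowFactor (suc (s +ℕ t))
                             ≡ pow (- 1#) (suc (s +ℕ t) +ℕ m +ℕ k) * pow (q ⁻¹) (s *ℕ t) * Ffact t * (qfact t ⁻¹) * Fbin (s +ℕ t) s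
      rowFactor-offset t = ≡.trans
        (≡.cong (λ d → σ * qpow (-ℤ (+ s *ℤ d)) * Ffactℤ d * (qfactℤ d ⁻¹) * Fbin (s +ℕ t) s) (+[a+t]-+a≡+t (suc s) t))
        (≡.cong (λ P → σ * P * Ffact t * (qfact t ⁻¹) * Fbin (s +ℕ t) s) (≡.trans (≡.cong (λ z → qpow (-ℤ z)) (≡.sym (ℤ.pos-* s t))) (qpow-neg (s *ℕ t))))
        where
        σ : Carrier
        σ = pow (- 1#) (suc (s +ℕ t) +ℕ m +ℕ k)

      rowFactor-step : ∀ t → F (suc (s +ℕ t)) * rowFactor (suc (s +ℕ t)) ≈ - (qint (suc t) * pow q s) * rowFactor (suc (s +ℕ suc t))
      rowFactor-step t = sym (begin
        - (I * Q) * rowFactor (suc (s +ℕ suc t))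
          ≡⟨ ≡.cong (- (I * Q) *_) (rowFactor-offset (suc t)) ⟩
        - (I * Q) * (σ′ * pow (q ⁻¹) (s *ℕ suc t) * Ffact (suc t) * (qfact (suc t) ⁻¹) * Fbin (s +ℕ suc t) s)
          ≈⟨ solve 6 (λ IQ σ P F Q B → IQ :* (σ :* P :* F :* Q :* B) := IQ :* (σ :* P :* Q :* (F :* B)))
                     refl (- (I * Q)) σ′ (pow (q ⁻¹) (s *ℕ suc t)) (Ffact (suc t)) (qfact (suc t) ⁻¹) (Fbin (s +ℕ suc t) s) ⟩
        - (I * Q) * (σ′ * pow (q ⁻¹) (s *ℕ suc t) * (qfact (suc t) ⁻¹) * (Ffact (suc t) * Fbin (s +ℕ suc t) s))
          ≈⟨ *-congˡ (*-cong (*-cong (*-cong (reflexive σ′≡-σ) P-step) (⁻¹-distrib-* (QB.fact≉0 t) ([i]≉0 t))) (FB.fact-*-binom-+ s t)) ⟩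
        - (I * Q) * (- 1# * σ * (Q⁻ * P) * (Qt * I ⁻¹) * (Fx * (Ffact t * B)))
          ≈⟨ solve 10 (λ I I⁻ Q Q⁻ σ P Ft Qt B Fx →
                :- (I :* Q) :* (:- con (+ 1) :* σ :* (Q⁻ :* P) :* (Qt :* I⁻) :* (Fx :* (Ft :* B)))
                := I :* I⁻ :* (Q :* Q⁻) :* (Fx :* (σ :* P :* Ft :* Qt :* B)))
              refl I (I ⁻¹) Q Q⁻ σ P (Ffact t) Qt B Fx ⟩
        I * I ⁻¹ * (Q * Q⁻) * (Fx * (σ * P * Ffact t * Qt * B))
          ≈⟨ *-congʳ (*-cong (⁻¹-inverse I ([i]≉0 t)) (pow-*-pow-⁻¹ s q≉0)) ⟩
        1# * 1# * (Fx * (σ * P * Ffact t * Qt * B))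
          ≈⟨ trans (*-congʳ (*-identityˡ 1#)) (*-identityˡ _) ⟩
        Fx * (σ * P * Ffact t * Qt * B)
          ≡⟨ ≡.cong (Fx *_) (rowFactor-offset t) ⟨
        Fx * rowFactor (suc (s +ℕ t)) ∎)
        where
        I Q Q⁻ P Qt Fx σ σ′ B : Carrier
        I = qint (suc t)
        Q = pow q s
        Q⁻ = pow (q ⁻¹) s
        P = pow (q ⁻¹) (s *ℕ t)
        Qt = qfact t ⁻¹
        Fx = F (suc (s +ℕ t))
        σ = pow (- 1#) (suc (s +ℕ t) +ℕ m +ℕ k)
        σ′ = pow (- 1#) (suc (s +ℕ suc t) +ℕ m +ℕ k)
        B = Fbin (s +ℕ t) s
        σ′≡-σ : σ′ ≡ - 1# * σ
        σ′≡-σ = ≡.cong (λ l → - 1# * pow (- 1#) (l +ℕ m +ℕ k)) (ℕ.+-suc s t)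
        P-step : pow (q ⁻¹) (s *ℕ suc t) ≈ Q⁻ * P
        P-step = trans (reflexive (≡.cong (pow (q ⁻¹)) (ℕ.*-suc s t))) (pow-+ (q ⁻¹) s (s *ℕ t))

      rowFactor-recurrence : ∀ n → F (suc n) * rowFactor (suc n) ≈ - (qint (suc (suc n) ∸ (m +ℕ k)) * pow q s) * rowFactor (suc (suc n))
      rowFactor-recurrence n with offset? s n
      ... | below n<s = begin
        F (suc n) * rowFactor (suc n)          ≈⟨ *-congˡ (rowFactor-below n<s) ⟩
        F (suc n) * 0#                         ≈⟨ zeroʳ _ ⟩
        0#                                     ≈⟨ solve 2 (λ a b → :- (con (+ 0) :* a) :* b := con (+ 0)) refl (pow q s) (rowFactor (suc (suc n))) ⟨
        - (qint 0 * pow q s) * rowFactor (suc (suc n))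
          ≡⟨ ≡.cong (λ l → - (qint l * pow q s) * rowFactor (suc (suc n))) (ℕ.m≤n⇒m∸n≡0 n<s) ⟨
        - (qint (suc n ∸ s) * pow q s) * rowFactor (suc (suc n)) ∎
      ... | offset t = begin
        F (suc (s +ℕ t)) * rowFactor (suc (s +ℕ t))
          ≈⟨ rowFactor-step t ⟩
        - (qint (suc t) * pow q s) * rowFactor (suc (s +ℕ suc t))
          ≡⟨ ≡.cong₂ (λ i j → - (qint i * pow q s) * rowFactor (suc j)) (≡.sym [1+s+t]∸s≡1+t) (ℕ.+-suc s t) ⟩
        - (qint (suc (s +ℕ t) ∸ s) * pow q s) * rowFactor (suc (suc (s +ℕ t))) ∎
        where
        [1+s+t]∸s≡1+t : suc (s +ℕ t) ∸ s ≡ suc t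
        [1+s+t]∸s≡1+t = ≡.trans (≡.cong (_∸ s) (≡.sym (ℕ.+-suc s t))) (ℕ.m+n∸m≡n s (suc t))

      columnFactor-offset : ∀ r → columnFactor (k +ℕ r) ≡ gaussCoeff m r
      columnFactor-offset r = ≡.cong (λ e → qpow (choose2 e) * qbin m e) (+[a+t]-+a≡+t k r)

      columnFactor-below : ∀ {j} → j < k → columnFactor j ≈ 0#
      columnFactor-below (s≤s j≤k′) = trans (*-congˡ (reflexive (≡.cong (qbin m) (+j-+[1+k]≡-[1+k∸j] j≤k′)))) (zeroʳ _)

      Xe-at-0 : ∀ i → Xe m k i 0 ≈ 0#
      Xe-at-0 i = trans (Xe-factorises i 0) (trans (*-congˡ (columnFactor-below (s≤s z≤n))) (zeroʳ _))

      Xe-below : ∀ {n} j → n < s → Xe m k (suc n) j ≈ 0#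
      Xe-below {n} j n<s = trans (Xe-factorises (suc n) j) (trans (*-congʳ (trans (*-congˡ (rowFactor-below n<s)) (zeroʳ a))) (zeroˡ _))

      Xe-above-diagonal : ∀ n → Xe m k (suc n) (suc (suc n)) ≈ 0#
      Xe-above-diagonal n with offset? s n
      ... | below n<s = Xe-below (suc (suc n)) n<s
      ... | offset t = trans (Xe-factorises (suc (s +ℕ t)) (suc (suc (s +ℕ t)))) (trans (*-congˡ C≈0) (zeroʳ _))
        where
        2+s+t≡k+[1+m+t] : ∀ m′ k′ t → suc (suc (m′ +ℕ suc k′ +ℕ t)) ≡ suc k′ +ℕ suc (suc m′ +ℕ t)
        2+s+t≡k+[1+m+t] = solve-∀
        C≈0 : columnFactor (suc (suc (s +ℕ t))) ≈ 0#
        C≈0 = begin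
          columnFactor (suc (suc (s +ℕ t)))       ≡⟨ ≡.cong columnFactor (2+s+t≡k+[1+m+t] m′ k′ t) ⟩
          columnFactor (k +ℕ suc (m +ℕ t))        ≡⟨ columnFactor-offset (suc (m +ℕ t)) ⟩
          gaussCoeff m (suc (m +ℕ t))    ≈⟨ gaussCoeff-vanishes (s≤s (ℕ.m≤m+n m t)) ⟩
          0#                                   ∎

      pow-s : pow q s ≈ pow q k′ * pow q m
      pow-s = trans (reflexive (≡.cong (pow q) (s≡k′+m m′ k′))) (pow-+ q k′ m)
        where
        s≡k′+m : ∀ m′ k′ → m′ +ℕ suc k′ ≡ k′ +ℕ suc m′
        s≡k′+m = solve-∀

      s+t∸[k′+i]≡[m+t]∸i : ∀ t i → s +ℕ t ∸ (k′ +ℕ i) ≡ m +ℕ t ∸ i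
      s+t∸[k′+i]≡[m+t]∸i t i = ≡.trans (≡.cong (_∸ (k′ +ℕ i)) (s+t≡k′+[m+t] m′ k′ t)) (ℕ.[m+n]∸[m+o]≡n∸o k′ (m +ℕ t) i)
        where
        s+t≡k′+[m+t] : ∀ m′ k′ t → m′ +ℕ suc k′ +ℕ t ≡ k′ +ℕ (suc m′ +ℕ t)
        s+t≡k′+[m+t] = solve-∀

      columnFactor-eigen : ∀ t J →
        - (qint t * pow q s) * (columnFactor (suc J) + columnFactor J)
          + pow q J * qint (s +ℕ t ∸ J) * columnFactor (suc J)
          + pow q (J ∸ 1) * qint (s +ℕ t ∸ (J ∸ 1)) * columnFactor J
        ≈ pow q k′ * qint m * columnFactor (suc J)
      columnFactor-eigen t J with offset? k′ J
      ... | below J<k′ = both-vanish _ _ _ _ (columnFactor-below (s≤s J<k′)) (columnFactor-below (ℕ.m<n⇒m<1+n J<k′))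
      ... | offset zero = begin
        - (qint t * pow q s) * (H + C₀) + pow q (k′ +ℕ 0) * qint (s +ℕ t ∸ (k′ +ℕ 0)) * H + W * C₀
          ≈⟨ +-cong (+-cong (*-cong (-‿cong (*-congˡ pow-s)) (+-congˡ C₀≈0))
                            (*-congʳ (*-cong (pow-+ q k′ 0) (trans (reflexive (≡.cong qint (s+t∸[k′+i]≡[m+t]∸i t 0))) (qint-+ m t)))))
                    (*-congˡ C₀≈0) ⟩
        - (qint t * (pow q k′ * pow q m)) * (H + 0#) + pow q k′ * 1# * (qint m + pow q m * qint t) * H + W * 0#
          ≈⟨ solve 6 (λ T Pk Pm Im H W → :- (T :* (Pk :* Pm)) :* (H :+ con (+ 0)) :+ Pk :* con (+ 1) :* (Im :+ Pm :* T) :* H :+ W :* con (+ 0)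
                                            := Pk :* Im :* H)
                     refl (qint t) (pow q k′) (pow q m) (qint m) H W ⟩
        pow q k′ * qint m * H ∎
        where
        H C₀ W : Carrier
        H = columnFactor (k +ℕ 0)
        C₀ = columnFactor (k′ +ℕ 0)
        W = pow q (k′ +ℕ 0 ∸ 1) * qint (s +ℕ t ∸ (k′ +ℕ 0 ∸ 1))
        C₀≈0 : C₀ ≈ 0#
        C₀≈0 = columnFactor-below (s≤s (ℕ.≤-reflexive (ℕ.+-identityʳ k′)))
      ... | offset (suc r) = begin
        - (qint t * pow q s) * (columnFactor (k +ℕ suc r) + columnFactor (k′ +ℕ suc r))
          + pow q (k′ +ℕ suc r) * qint (s +ℕ t ∸ (k′ +ℕ suc r)) * columnFactor (k +ℕ suc r) + pow q (k′ +ℕ suc r ∸ 1) * qint (s +ℕ t ∸ (k′ +ℕ suc r ∸ 1)) * columnFactor (k′ +ℕ suc r)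
          ≈⟨ +-cong (+-cong (*-cong (-‿cong (*-congˡ pow-s)) (+-cong C₁≈H₁ C₀≈H₀))
                            (*-cong (*-cong (pow-+ q k′ (suc r)) (reflexive (≡.cong qint (s+t∸[k′+i]≡[m+t]∸i t (suc r))))) C₁≈H₁))
                    (*-cong (*-cong (trans (reflexive (≡.cong (pow q) k′+1+r∸1≡k′+r)) (pow-+ q k′ r))
                                    (reflexive (≡.cong qint (≡.trans (≡.cong (s +ℕ t ∸_) k′+1+r∸1≡k′+r) (s+t∸[k′+i]≡[m+t]∸i t r)))))
                            C₀≈H₀) ⟩
        - (qint t * (pow q k′ * pow q m)) * (H₁ + H₀)
          + pow q k′ * pow q (suc r) * qint (m +ℕ t ∸ suc r) * H₁ + pow q k′ * pow q r * qint (m +ℕ t ∸ r) * H₀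
          ≈⟨ solve 9 (λ T Pk Pm P₁ I₁ P₀ I₀ H₁ H₀ →
                        :- (T :* (Pk :* Pm)) :* (H₁ :+ H₀) :+ Pk :* P₁ :* I₁ :* H₁ :+ Pk :* P₀ :* I₀ :* H₀
                        := Pk :* (:- (T :* Pm) :* (H₁ :+ H₀) :+ P₁ :* I₁ :* H₁ :+ P₀ :* I₀ :* H₀))
                     refl (qint t) (pow q k′) (pow q m) (pow q (suc r)) (qint (m +ℕ t ∸ suc r)) (pow q r) (qint (m +ℕ t ∸ r)) H₁ H₀ ⟩
        pow q k′ * (- (qint t * pow q m) * (H₁ + H₀) + pow q (suc r) * qint (m +ℕ t ∸ suc r) * H₁ + pow q r * qint (m +ℕ t ∸ r) * H₀)
          ≈⟨ *-congˡ (gaussCoeff-eigen m t r) ⟩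
        pow q k′ * (qint m * H₁)
          ≈⟨ *-assoc _ _ _ ⟨
        pow q k′ * qint m * H₁
          ≈⟨ *-congˡ C₁≈H₁ ⟨
        pow q k′ * qint m * columnFactor (k +ℕ suc r) ∎
        where
        H₁ H₀ : Carrier
        H₁ = gaussCoeff m (suc r)
        H₀ = gaussCoeff m r
        C₁≈H₁ : columnFactor (k +ℕ suc r) ≈ H₁
        C₁≈H₁ = reflexive (columnFactor-offset (suc r))
        C₀≈H₀ : columnFactor (k′ +ℕ suc r) ≈ H₀
        C₀≈H₀ = reflexive (≡.trans (≡.cong columnFactor (ℕ.+-suc k′ r)) (columnFactor-offset r))
        k′+1+r∸1≡k′+r : k′ +ℕ suc r ∸ 1 ≡ k′ +ℕ r
        k′+1+r∸1≡k′+r = ≡.cong (_∸ 1) (ℕ.+-suc k′ r)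

      rowFactor-*-columnFactor-eigen : ∀ N J →
        rowFactor (suc N) * (- (qint (suc N ∸ (m +ℕ k)) * pow q s) * (columnFactor (suc J) + columnFactor J)
                             + pow q J * qint (N ∸ J) * columnFactor (suc J)
                             + pow q (J ∸ 1) * qint (N ∸ (J ∸ 1)) * columnFactor J)
          ≈ rowFactor (suc N) * (pow q k′ * qint m * columnFactor (suc J))
      rowFactor-*-columnFactor-eigen N J with offset? s N
      ... | below N<s = trans (*-congʳ (rowFactor-below N<s)) (trans (zeroˡ _) (sym (trans (*-congʳ (rowFactor-below N<s)) (zeroˡ _))))
      ... | offset t = *-congˡ (trans (reflexive (≡.cong (λ i → - (qint i * pow q s) * (columnFactor (suc J) + columnFactor J)
                                                             + pow q J * qint (s +ℕ t ∸ J) * columnFactor (suc J)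
                                                             + pow q (J ∸ 1) * qint (s +ℕ t ∸ (J ∸ 1)) * columnFactor J)
                                                        (ℕ.m+n∸m≡n s t)))
                                      (columnFactor-eigen t J))

      last-block-combination : ∀ n J →
        - (a * F (suc n)) * Xe m k (suc n) (suc J) + - (a * F (suc n)) * Xe m k (suc n) J
          + ((x - a * (pow q J * qint (suc n ∸ J))) * Xe m k (suc (suc n)) (suc J)
             + - (a * (pow q (J ∸ 1) * qint (suc n ∸ (J ∸ 1)))) * Xe m k (suc (suc n)) J)
        ≈ μ * Xe m k (suc (suc n)) (suc J)
      last-block-combination n J = begin
        - (a * Fx) * Xe m k (suc n) (suc J) + - (a * Fx) * Xe m k (suc n) J
          + ((x - a * B₁) * Xe m k (suc (suc n)) (suc J) + - (a * B₀) * Xe m k (suc (suc n)) J)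
          ≈⟨ +-cong (+-cong (*-congˡ (Xe-factorises (suc n) (suc J))) (*-congˡ (Xe-factorises (suc n) J)))
                    (+-cong (*-congˡ (Xe-factorises (suc (suc n)) (suc J))) (*-congˡ (Xe-factorises (suc (suc n)) J))) ⟩
        - (a * Fx) * (a * ρ′ * C₁) + - (a * Fx) * (a * ρ′ * C₀) + ((x - a * B₁) * (a * ρ * C₁) + - (a * B₀) * (a * ρ * C₀))
          ≈⟨ solve 9 (λ x a Fx ρ′ ρ C₁ C₀ B₁ B₀ →
                :- (a :* Fx) :* (a :* ρ′ :* C₁) :+ :- (a :* Fx) :* (a :* ρ′ :* C₀) :+ ((x :- a :* B₁) :* (a :* ρ :* C₁) :+ :- (a :* B₀) :* (a :* ρ :* C₀))
                := x :* (a :* ρ :* C₁) :- a :* a :* (Fx :* ρ′ :* (C₁ :+ C₀) :+ ρ :* (B₁ :* C₁ :+ B₀ :* C₀)))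
              refl x a Fx ρ′ ρ C₁ C₀ B₁ B₀ ⟩
        x * (a * ρ * C₁) - a * a * (Fx * ρ′ * (C₁ + C₀) + ρ * (B₁ * C₁ + B₀ * C₀))
          ≈⟨ +-congˡ (-‿cong (*-congˡ (+-congʳ (*-congʳ (rowFactor-recurrence n))))) ⟩
        x * (a * ρ * C₁) - a * a * (- γ * ρ * (C₁ + C₀) + ρ * (B₁ * C₁ + B₀ * C₀))
          ≈⟨ solve 8 (λ x a ρ C₁ C₀ B₁ B₀ γ →
                x :* (a :* ρ :* C₁) :- a :* a :* (:- γ :* ρ :* (C₁ :+ C₀) :+ ρ :* (B₁ :* C₁ :+ B₀ :* C₀))
                := x :* (a :* ρ :* C₁) :- a :* a :* (ρ :* (:- γ :* (C₁ :+ C₀) :+ B₁ :* C₁ :+ B₀ :* C₀)))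
              refl x a ρ C₁ C₀ B₁ B₀ γ ⟩
        x * (a * ρ * C₁) - a * a * (ρ * (- γ * (C₁ + C₀) + B₁ * C₁ + B₀ * C₀))
          ≈⟨ +-congˡ (-‿cong (*-congˡ (rowFactor-*-columnFactor-eigen (suc n) J))) ⟩
        x * (a * ρ * C₁) - a * a * (ρ * (pow q k′ * qint m * C₁))
          ≈⟨ solve 6 (λ x a ρ C₁ Pk Im → x :* (a :* ρ :* C₁) :- a :* a :* (ρ :* (Pk :* Im :* C₁)) := (x :- a :* Pk :* Im) :* (a :* ρ :* C₁))
                     refl x a ρ C₁ (pow q k′) (qint m) ⟩
        μ * (a * ρ * C₁)
          ≈⟨ *-congˡ (Xe-factorises (suc (suc n)) (suc J)) ⟨
        μ * Xe m k (suc (suc n)) (suc J)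
          ∎
        where
        Fx ρ′ ρ C₁ C₀ B₁ B₀ γ : Carrier
        Fx = F (suc n)
        ρ′ = rowFactor (suc n)
        ρ = rowFactor (suc (suc n))
        C₁ = columnFactor (suc J)
        C₀ = columnFactor J
        B₁ = pow q J * qint (suc n ∸ J)
        B₀ = pow q (J ∸ 1) * qint (suc n ∸ (J ∸ 1))
        γ = qint (suc (suc n) ∸ (m +ℕ k)) * pow q s

      rowMul-last-block : ∀ n (j : Fin (suc (suc n))) →
        rowMul (T (suc (suc n))) (X m k (suc n)) (N (suc n)) (T (suc n) ↑ʳ j) ≈ μ * X m k (suc n) (T (suc n) ↑ʳ j)
      rowMul-last-block n j = begin
        rowMul (T (suc (suc n))) (X m k (suc n)) (N (suc n)) (T (suc n) ↑ʳ j)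
          ≈⟨ rowMul-↑ʳ m k n j ⟩
        ∑ (suc n) (λ i → Y (suc (toℕ i)) * - (a * F (suc n) * (δ (toℕ i) J + δ (suc (toℕ i)) J)))
          + ∑ (suc (suc n)) (λ i → Z (suc (toℕ i)) * Nhat n i j)
          ≈⟨ +-cong Nbar-part Nhat-part ⟩
        - (a * F (suc n)) * Y (suc J) + - (a * F (suc n)) * Y J + (d J * Z (suc J) + e (J ∸ 1) * Z J)
          ≈⟨ last-block-combination n J ⟩
        μ * Z (suc J)
          ≡⟨ ≡.cong (μ *_) (X-↑ʳ m k n j) ⟨
        μ * X m k (suc n) (T (suc n) ↑ʳ j)
          ∎
        where
        J : ℕ
        J = toℕ j
        J≤1+n : J ≤ suc n
        J≤1+n = ℕ.≤-pred (Fin.toℕ<n j)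
        Y Z : ℕ → Carrier
        Y = Xe m k (suc n)
        Z = Xe m k (suc (suc n))
        d e : ℕ → Carrier
        d p = x - a * (pow q p * qint (suc n ∸ p))
        e p = - (a * (pow q p * qint (suc n ∸ p)))
        Nbar-part : ∑ (suc n) (λ i → Y (suc (toℕ i)) * - (a * F (suc n) * (δ (toℕ i) J + δ (suc (toℕ i)) J)))
                    ≈ - (a * F (suc n)) * Y (suc J) + - (a * F (suc n)) * Y J
        Nbar-part = trans
          (∑-cong (suc n) (λ i → solve 4 (λ y u δ₀ δ₁ → y :* (:- (u :* (δ₀ :+ δ₁))) := y :* (:- u :* δ₀ :+ :- u :* δ₁))
                                         refl (Y (suc (toℕ i))) (a * F (suc n)) (δ (toℕ i) J) (δ (suc (toℕ i)) J)))
          (∑-bidiagonal (suc n) Y (λ _ → - (a * F (suc n))) (λ _ → - (a * F (suc n))) J≤1+n (Xe-at-0 (suc n)) (Xe-above-diagonal n))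
        Nhat-part : ∑ (suc (suc n)) (λ i → Z (suc (toℕ i)) * Nhat n i j) ≈ d J * Z (suc J) + e (J ∸ 1) * Z J
        Nhat-part = trans
          (∑-cong (suc (suc n)) (λ i → solve 7 (λ z x δ₀ δ₁ a P I → z :* (x :* δ₀ :- a :* P :* I :* (δ₀ :+ δ₁))
                                                                 := z :* ((x :- a :* (P :* I)) :* δ₀ :+ :- (a :* (P :* I)) :* δ₁))
                                               refl (Z (suc (toℕ i))) x (δ (toℕ i) J) (δ (suc (toℕ i)) J) a (pow q (toℕ i)) (qint (suc n ∸ toℕ i))))
          (∑-bidiagonal (suc (suc n)) Z d e (ℕ.m≤n⇒m≤1+n J≤1+n) (Xe-at-0 (suc (suc n))) (Xe-above-diagonal (suc n)))

      X-left-eigenvector : ∀ n (col : Fin (T (suc n))) → rowMul (T (suc n)) (X m k n) (N n) col ≈ μ * X m k n col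
      X-left-eigenvector zero fzero = begin
        Xe m k 1 1 * x + 0#   ≈⟨ +-identityʳ _ ⟩
        Xe m k 1 1 * x        ≈⟨ *-congʳ Xe₁₁≈0 ⟩
        0# * x                ≈⟨ zeroˡ x ⟩
        0#                    ≈⟨ trans (*-congˡ Xe₁₁≈0) (zeroʳ μ) ⟨
        μ * Xe m k 1 1        ∎
        where
        Xe₁₁≈0 : Xe m k 1 1 ≈ 0#
        Xe₁₁≈0 = Xe-below 1 (ℕ.≤-trans (s≤s z≤n) (ℕ.m≤n+m k m′))
      X-left-eigenvector (suc n) col with block (T (suc n)) (suc (suc n)) col
      ... | left c′ = begin
        rowMul (T (suc (suc n))) (X m k (suc n)) (N (suc n)) (c′ ↑ˡ suc (suc n))  ≈⟨ rowMul-↑ˡ m k n c′ ⟩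
        rowMul (T (suc n)) (X m k n) (N n) c′                                    ≈⟨ X-left-eigenvector n c′ ⟩
        μ * X m k n c′                                                           ≡⟨ ≡.cong (μ *_) (X-↑ˡ m k n c′) ⟨
        μ * X m k (suc n) (c′ ↑ˡ suc (suc n))                                    ∎
      ... | right j = rowMul-last-block n j

lemma3p15 : ∀ {c ℓ : Level} (K : Field c ℓ)
              (q : Field.Carrier K) (F : ℕ → Field.Carrier K) (x a : Field.Carrier K) →
              let open Field K
                  open Construction K q F x a
              in ¬ (q ≈ 0#) →
                 (∀ i → ¬ (qint (suc i) ≈ 0#)) →
                 (∀ i → ¬ (F (suc i) ≈ 0#)) →
                 (n m k : ℕ) → 1 ≤ n → 1 ≤ m → m ≤ n ∸ 1 → 1 ≤ k → k ≤ n ∸ m →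
                 (col : Fin (T (suc n))) →
                 rowMul (T (suc n)) (X m k n) (N n) col
                   ≈ (x - a * pow q (k ∸ 1) * qint m) * X m k n col
lemma3p15 K q F x a q≉0 [i]≉0 F≉0 n (suc m′) (suc k′) _ _ _ _ _ col =
  X-left-eigenvector K q F x a [i]≉0 q≉0 F≉0 m′ k′ n col
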